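{- Let $G=(V,E)$ be a finite simple undirected graph with a vertex coloring $c:V\to C$, and for each $c\in C$ let $s_c=\max_{V'\subseteq V_c}(|V'|-|N_{C\setminus\{c\}}(V')|)$, where $V_c$ is the set of vertices of color $c$. Then every subgraph $G''=(V,E'')$ with $E''\subseteq E$ in which every connected component is colorful has at least $\sum_{c\in C}s_c$ isolated (singleton) vertices.
   Context: For $V'\subseteq V$, $N(V')=\{v\in V\setminus V' : \exists v'\in V',\ (v',v)\in E\}$ and for $C'\subseteq C$, $N_{C'}(V')=\{v\in N(V') : c(v)\in C'\}$ (neighbors taken in $G$). A connected component is colorful if no two of its vertices share a color. -}

module Defs where

open import Data.Nat using (ℕ; zero; suc)
open import Data.Bool using (Bool; true; false; not; _∧_; if_then_else_)
open import Data.Fin using (Fin; _≟_)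
open import Data.Fin.Subset using (Subset; _⊆_; ∣_∣; ⊥)
open import Data.Fin.Subset.Properties using (_∈?_; _⊆?_)
open import Data.Vec using (Vec; []; _∷_; tabulate; lookup)
open import Data.List using (List; []; _∷_; map; _++_; foldr; filter; allFin)
open import Data.Integer using (ℤ; +_; _-_; _⊔_)
open import Data.Product using (_×_)
open import Relation.Nullary.Decidable using (⌊_⌋)
open import Relation.Binary.PropositionalEquality using (_≡_)
open import Relation.Binary.Construct.Closure.ReflexiveTransitive using (Star)

record SimpleGraph (n : ℕ) : Set where
  field
    adj    : Fin n → Fin n → Bool
    sym    : ∀ u v → adj u v ≡ adj v u
    irrefl : ∀ v → adj v v ≡ false
open SimpleGraph public

anyFin : ∀ {n} → (Fin n → Bool) → Bool
anyFin {n} p = foldr (λ v b → if p v then true else b) false (allFin n)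

allSubsets : ∀ n → List (Subset n)
allSubsets zero    = [] ∷ []
allSubsets (suc n) = map (true ∷_) (allSubsets n) ++ map (false ∷_) (allSubsets n)

maxOver : ∀ {A : Set} → (A → ℤ) → A → List A → ℤ
maxOver f a xs = foldr (λ x m → f x ⊔ m) (f a) xs

module _ {n k : ℕ} (G : SimpleGraph n) (col : Fin n → Fin k) where

  colorClass : Fin k → Subset n
  colorClass c = tabulate (λ v → ⌊ col v ≟ c ⌋)

  N : Subset n → Subset n
  N V' = tabulate (λ v → not ⌊ v ∈? V' ⌋ ∧ anyFin (λ v' → ⌊ v' ∈? V' ⌋ ∧ adj G v' v))

  NOther : Fin k → Subset n → Subset n
  NOther c V' = tabulate (λ v → lookup (N V') v ∧ not ⌊ col v ≟ c ⌋)

  surplus : Fin k → Subset n → ℤ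
  surplus c V' = + ∣ V' ∣ - + ∣ NOther c V' ∣

  -- s_c = max over V' ⊆ V_c of (|V'| - |N_{C\{c}}(V')|);
  -- the maximum is taken over all subsets of Fin n contained in V_c
  -- (the empty subset is always among them).
  s : Fin k → ℤ
  s c = maxOver (surplus c) ⊥ (filter (_⊆? colorClass c) (allSubsets n))

  sumS : ℤ
  sumS = foldr (λ c acc → s c Data.Integer.+ acc) (+ 0) (allFin k)

IsSubgraph : ∀ {n} → SimpleGraph n → (Fin n → Fin n → Bool) → Set
IsSubgraph G E'' = (∀ u v → E'' u v ≡ E'' v u) × (∀ u v → E'' u v ≡ true → adj G u v ≡ true)

Connected : ∀ {n} → (Fin n → Fin n → Bool) → Fin n → Fin n → Set
Connected E'' = Star (λ u v → E'' u v ≡ true)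

AllComponentsColorful : ∀ {n k} → (Fin n → Fin n → Bool) → (Fin n → Fin k) → Set
AllComponentsColorful E'' col = ∀ u v → Connected E'' u v → col u ≡ col v → u ≡ v

isolatedᵇ : ∀ {n} → (Fin n → Fin n → Bool) → Fin n → Bool
isolatedᵇ E'' v = not (anyFin (λ u → E'' v u))

numIsolated : ∀ {n} → (Fin n → Fin n → Bool) → ℕ
numIsolated {n} E'' = ∣ tabulate {n = n} (isolatedᵇ E'') ∣

-- Fix a color c and V' ⊆ V_c. Every non-isolated vertex v ∈ V' has a neighbour u in G''.
-- As G'' is colorful, u has a color other than c (so u ∉ V' and u ∈ N_{C∖{c}}(V')), and two
-- vertices of V' sharing the neighbour u would be distinct vertices of the same color in one
-- component. Hence v ↦ u is injective, and |V'| ≤ |N_{C∖{c}}(V')| + (isolated vertices of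
-- color c), i.e. s_c is at most the number of isolated vertices of color c. Summing over c
-- gives the bound.
module Submission where

open import Data.Bool using (Bool; true; false; not; _∧_; if_then_else_)
open import Data.Bool.Properties using (∧-identityʳ; ∧-zeroʳ; not-involutive; ¬-not)
open import Data.Fin using (Fin; zero; suc; _≟_)
open import Data.Fin.Properties using (0≢1+n; suc-injective)
open import Data.Fin.Subset using (Subset; _⊆_; ∣_∣)
open import Data.Fin.Subset.Properties using (_∈?_; _⊆?_; ⊆-min)
open import Data.Integer as ℤ using (ℤ; +_; _≤_; _⊖_)
import Data.Integer.Properties as ℤP
open import Data.List using ([]; _∷_; foldr; tabulate; allFin)
open import Data.List.Membership.Propositional using (_∈_)
open import Data.List.Membership.Propositional.Properties using (∈-allFin)
open import Data.List.Relation.Unary.All using (All; []; _∷_)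
open import Data.List.Relation.Unary.All.Properties using (all-filter)
open import Data.List.Relation.Unary.Any using (here; there)
open import Data.Nat as ℕ using (ℕ; zero; suc; z≤n; s≤s)
import Data.Nat.Properties as ℕP
open import Algebra.Properties.CommutativeMonoid.Sum ℕP.+-0-commutativeMonoid
  using (sum-syntax; sum-cong-≗; sum-replicate-zero; ∑-distrib-+; ∑-comm)
open import Data.Product using (∃; _,_; _×_; proj₁; proj₂)
open import Data.Vec as Vec using ([]; _∷_; lookup)
open import Data.Vec.Properties using (lookup∘tabulate; []=⇒lookup; lookup⇒[]=)
open import Function using (id; _∘_)
open import Relation.Binary.Construct.Closure.ReflexiveTransitive using (ε; _◅_)
open import Relation.Binary.PropositionalEquality
open import Relation.Nullary using (Dec; ¬_; yes; no; contradiction)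
open import Relation.Nullary.Decidable using (⌊_⌋; ⌊⌋-map′; dec-true; dec-false; isYes≗does)

open import Defs hiding (sym)

⌊⌋≡true⇒ : ∀ {A : Set} (a? : Dec A) → ⌊ a? ⌋ ≡ true → A
⌊⌋≡true⇒ (yes a) _  = a
⌊⌋≡true⇒ (no _)  ()

⌊⌋≡true : ∀ {A : Set} (a? : Dec A) → A → ⌊ a? ⌋ ≡ true
⌊⌋≡true a? a = trans (isYes≗does a?) (dec-true a? a)

⌊⌋≡false : ∀ {A : Set} (a? : Dec A) → ¬ A → ⌊ a? ⌋ ≡ false
⌊⌋≡false a? ¬a = trans (isYes≗does a?) (dec-false a? ¬a)

∧≡true : ∀ {a b} → a ∧ b ≡ true → a ≡ true × b ≡ true
∧≡true {true} b≡true = refl , b≡true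

indicator : Bool → ℕ
indicator true  = 1
indicator false = 0

count : ∀ {n} → (Fin n → Bool) → ℕ
count {n} p = ∑[ v < n ] indicator (p v)

∣p∣≡count : ∀ {n} (p : Subset n) → ∣ p ∣ ≡ count (lookup p)
∣p∣≡count []          = refl
∣p∣≡count (true  ∷ p) = cong suc (∣p∣≡count p)
∣p∣≡count (false ∷ p) = ∣p∣≡count p

count-cong : ∀ {n} {p q : Fin n → Bool} → (∀ v → p v ≡ q v) → count p ≡ count q
count-cong p≗q = sum-cong-≗ (cong indicator ∘ p≗q)

count-false : ∀ {n} {p : Fin n → Bool} → (∀ v → p v ≡ false) → count p ≡ 0
count-false {n} p≗false = trans (count-cong p≗false) (sum-replicate-zero n)

count-mono : ∀ {n} {p q : Fin n → Bool} → (∀ v → p v ≡ true → q v ≡ true) → count p ℕ.≤ count q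
count-mono {zero}  p⇒q = z≤n
count-mono {suc n} p⇒q = ℕP.+-mono-≤ (indicator-mono (p⇒q zero)) (count-mono (p⇒q ∘ suc))
  where
  indicator-mono : ∀ {a b} → (a ≡ true → b ≡ true) → indicator a ℕ.≤ indicator b
  indicator-mono {false} a⇒b = z≤n
  indicator-mono {true}  a⇒b rewrite a⇒b refl = ℕP.≤-refl

count-split : ∀ {n} (p q : Fin n → Bool) →
              count p ≡ count (λ v → p v ∧ q v) ℕ.+ count (λ v → p v ∧ not (q v))
count-split p q = trans (sum-cong-≗ (λ v → indicator-split (p v) (q v)))
                        (∑-distrib-+ (λ v → indicator (p v ∧ q v)) (λ v → indicator (p v ∧ not (q v))))
  where
  indicator-split : ∀ a b → indicator a ≡ indicator (a ∧ b) ℕ.+ indicator (a ∧ not b)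
  indicator-split false b     = refl
  indicator-split true  false = refl
  indicator-split true  true  = refl

count-δ : ∀ {n} (q : Fin n → Bool) t → count (λ u → q u ∧ ⌊ t ≟ u ⌋) ≡ indicator (q t)
count-δ {suc n} q zero =
  trans (cong₂ ℕ._+_ (cong indicator (∧-identityʳ (q zero))) (count-false (∧-zeroʳ ∘ q ∘ suc)))
        (ℕP.+-identityʳ _)
count-δ {suc n} q (suc t) =
  trans (cong₂ ℕ._+_ (cong indicator (∧-zeroʳ (q zero)))
                     (count-cong (λ u → cong (q (suc u) ∧_) (⌊⌋-map′ _ _ (t ≟ u)))))
        (count-δ (q ∘ suc) t)

count-remove : ∀ {n} (q : Fin n → Bool) t → q t ≡ true →
               count q ≡ suc (count (λ u → q u ∧ not ⌊ t ≟ u ⌋))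
count-remove q t qt = begin
  count q                                ≡⟨ count-split q (λ u → ⌊ t ≟ u ⌋) ⟩
  count (λ u → q u ∧ ⌊ t ≟ u ⌋) ℕ.+ count q∖t
                                         ≡⟨ cong (ℕ._+ count q∖t) (trans (count-δ q t) (cong indicator qt)) ⟩
  suc (count q∖t)                        ∎
  where
  open ≡-Reasoning
  q∖t : _ → Bool
  q∖t u = q u ∧ not ⌊ t ≟ u ⌋

count-≤-injection : ∀ {m n} {p : Fin n → Bool} {q : Fin m → Bool}
  (f : ∀ v → p v ≡ true → Fin m) → (∀ v pv → q (f v pv) ≡ true) →
  (∀ v w pv pw → f v pv ≡ f w pw → v ≡ w) → count p ℕ.≤ count q
count-≤-injection {n = zero} f f∈q f-inj = z≤n
count-≤-injection {m} {suc n} {p} {q} f f∈q f-inj with p zero in p₀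
... | false = count-≤-injection (f ∘ suc) (f∈q ∘ suc) (λ v w pv pw → suc-injective ∘ f-inj _ _ pv pw)
... | true  = begin
  suc (count (p ∘ suc)) ≤⟨ s≤s (count-≤-injection (f ∘ suc) f∘suc∈q′ (λ v w pv pw → suc-injective ∘ f-inj _ _ pv pw)) ⟩
  suc (count q′)        ≡⟨ count-remove q (f zero p₀) (f∈q zero p₀) ⟨
  count q               ∎
  where
  open ℕP.≤-Reasoning
  q′ : Fin m → Bool
  q′ u = q u ∧ not ⌊ f zero p₀ ≟ u ⌋
  f∘suc∈q′ : ∀ v pv → q′ (f (suc v) pv) ≡ true
  f∘suc∈q′ v pv = cong₂ (λ a b → a ∧ not b) (f∈q (suc v) pv)
                        (⌊⌋≡false (f zero p₀ ≟ _) (0≢1+n ∘ f-inj zero (suc v) p₀ pv))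

∑-count-fibres : ∀ {n k} (p : Fin n → Bool) (f : Fin n → Fin k) →
                 ∑[ c < k ] count (λ v → p v ∧ ⌊ f v ≟ c ⌋) ≡ count p
∑-count-fibres p f =
  trans (∑-comm (λ c v → indicator (p v ∧ ⌊ f v ≟ c ⌋)))
        (sum-cong-≗ (λ v → count-δ (λ _ → p v) (f v)))

foldr-if-witness : ∀ {A : Set} (p : A → Bool) xs →
  foldr (λ x b → if p x then true else b) false xs ≡ true → ∃ λ x → p x ≡ true
foldr-if-witness p (x ∷ xs) any-p with p x in px
... | true  = x , px
... | false = foldr-if-witness p xs any-p

foldr-if-intro : ∀ {A : Set} (p : A → Bool) {x xs} → x ∈ xs → p x ≡ true →
  foldr (λ x b → if p x then true else b) false xs ≡ true
foldr-if-intro p (here refl) px rewrite px = refl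
foldr-if-intro p {xs = y ∷ _} (there x∈xs) px with p y
... | true  = refl
... | false = foldr-if-intro p x∈xs px

anyFin-witness : ∀ {n} {p : Fin n → Bool} → anyFin p ≡ true → ∃ λ v → p v ≡ true
anyFin-witness {n} {p} = foldr-if-witness p (allFin n)

anyFin-intro : ∀ {n} (p : Fin n → Bool) v → p v ≡ true → anyFin p ≡ true
anyFin-intro p v = foldr-if-intro p (∈-allFin v)

⌊∈?⌋≡lookup : ∀ {n} (V' : Subset n) v → ⌊ v ∈? V' ⌋ ≡ lookup V' v
⌊∈?⌋≡lookup (true  ∷ V') zero    = refl
⌊∈?⌋≡lookup (false ∷ V') zero    = refl
⌊∈?⌋≡lookup (_     ∷ V') (suc v) = trans (⌊⌋-map′ _ _ (v ∈? V')) (⌊∈?⌋≡lookup V' v)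

module _ {n k} (G : SimpleGraph n) (col : Fin n → Fin k) where

  ∈-colorClass : ∀ {c V' v} → V' ⊆ colorClass G col c → lookup V' v ≡ true → col v ≡ c
  ∈-colorClass {c} {V'} {v} V'⊆V_c v∈V' = ⌊⌋≡true⇒ (col v ≟ c)
    (trans (sym (lookup∘tabulate _ v)) ([]=⇒lookup (V'⊆V_c (lookup⇒[]= v V' v∈V'))))

  ∈-NOther : ∀ {c V'} u v → lookup V' v ≡ true → lookup V' u ≡ false → adj G v u ≡ true →
             col u ≢ c → lookup (NOther G col c V') u ≡ true
  ∈-NOther {c} {V'} u v v∈V' u∉V' vu col-u≢c = begin
    lookup (NOther G col c V') u
      ≡⟨ lookup∘tabulate _ u ⟩
    lookup (N G col V') u ∧ not ⌊ col u ≟ c ⌋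
      ≡⟨ cong₂ (λ a b → a ∧ not b) (lookup∘tabulate _ u) (⌊⌋≡false (col u ≟ c) col-u≢c) ⟩
    (not ⌊ u ∈? V' ⌋ ∧ anyFin (λ v' → ⌊ v' ∈? V' ⌋ ∧ adj G v' u)) ∧ true
      ≡⟨ cong₂ (λ a b → (not a ∧ b) ∧ true) (trans (⌊∈?⌋≡lookup V' u) u∉V')
               (anyFin-intro _ v (cong₂ _∧_ (trans (⌊∈?⌋≡lookup V' v) v∈V') vu)) ⟩
    true ∎
    where open ≡-Reasoning

+-∸-≤ : ∀ {a b d} → a ℕ.≤ b ℕ.+ d → + a ℤ.- + b ≤ + d
+-∸-≤ {a} {b} {d} a≤b+d = begin
  + a ℤ.- + b          ≡⟨ ℤP.[+m]-[+n]≡m⊖n a b ⟩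
  a ⊖ b                ≤⟨ ℤP.⊖-monoˡ-≤ b a≤b+d ⟩
  b ℕ.+ d ⊖ b          ≡⟨ ℤP.≤-⊖ (ℕP.m≤m+n b d) ⟩
  + (b ℕ.+ d ℕ.∸ b)    ≡⟨ cong +_ (ℕP.m+n∸m≡n b d) ⟩
  + d                  ∎
  where open ℤP.≤-Reasoning

maxOver-≤ : ∀ {A : Set} {P : A → Set} (f : A → ℤ) {a xs b} →
            (∀ {x} → P x → f x ≤ b) → P a → All P xs → maxOver f a xs ≤ b
maxOver-≤ f bound Pa []         = bound Pa
maxOver-≤ f bound Pa (Px ∷ Pxs) = ℤP.⊔-lub (bound Px) (maxOver-≤ f bound Pa Pxs)

foldr-+-≤-∑ : ∀ {k m} (h : Fin k → Fin m) (f : Fin m → ℤ) (g : Fin m → ℕ) → (∀ c → f c ≤ + g c) →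
              foldr (λ c acc → f c ℤ.+ acc) (+ 0) (tabulate h) ≤ + ∑[ i < k ] g (h i)
foldr-+-≤-∑ {zero}  h f g f≤g = ℤP.≤-refl
foldr-+-≤-∑ {suc k} h f g f≤g = ℤP.+-mono-≤ (f≤g (h zero)) (foldr-+-≤-∑ (h ∘ suc) f g f≤g)

module ColorfulSubgraph {n k} (G : SimpleGraph n) (col : Fin n → Fin k)
  (E'' : Fin n → Fin n → Bool) (E''⊆E : IsSubgraph G E'')
  (colorful : AllComponentsColorful E'' col) where

  adjacent-colors-differ : ∀ {u v} → E'' u v ≡ true → col u ≢ col v
  adjacent-colors-differ {u} {v} uv same-color with colorful u v (uv ◅ ε) same-color
  ... | refl = contradiction (trans (sym (irrefl G u)) (proj₂ E''⊆E u u uv)) λ ()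

  common-neighbour-same-color⇒≡ : ∀ {v w u} → E'' v u ≡ true → E'' w u ≡ true → col v ≡ col w → v ≡ w
  common-neighbour-same-color⇒≡ {v} {w} {u} vu wu = colorful v w (vu ◅ trans (proj₁ E''⊆E u w) wu ◅ ε)

  isolatedOfColor : Fin k → ℕ
  isolatedOfColor c = count (λ v → isolatedᵇ E'' v ∧ ⌊ col v ≟ c ⌋)

  numIsolated≡∑-isolatedOfColor : numIsolated E'' ≡ ∑[ c < k ] isolatedOfColor c
  numIsolated≡∑-isolatedOfColor =
    trans (∣p∣≡count (Vec.tabulate (isolatedᵇ E'')))
          (trans (count-cong (lookup∘tabulate (isolatedᵇ E''))) (sym (∑-count-fibres _ col)))

  module _ {c V'} (V'⊆V_c : V' ⊆ colorClass G col c) where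

    private
      NonIsolated : Fin n → Bool
      NonIsolated v = lookup V' v ∧ not (isolatedᵇ E'' v)

      neighbour : ∀ v → NonIsolated v ≡ true → ∃ λ u → E'' v u ≡ true
      neighbour v nonIsolated =
        anyFin-witness (trans (sym (not-involutive _)) (proj₂ (∧≡true nonIsolated)))

      neighbour∈NOther : ∀ v nonIsolated → lookup (NOther G col c V') (proj₁ (neighbour v nonIsolated)) ≡ true
      neighbour∈NOther v nonIsolated =
        ∈-NOther G col u v v∈V' (¬-not (col-u≢c ∘ ∈-colorClass G col V'⊆V_c)) (proj₂ E''⊆E v u vu) col-u≢c
        where
        u = proj₁ (neighbour v nonIsolated)
        vu = proj₂ (neighbour v nonIsolated)
        v∈V' = proj₁ (∧≡true nonIsolated)
        col-u≢c : col u ≢ c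
        col-u≢c col-u≡c = adjacent-colors-differ vu (trans (∈-colorClass G col V'⊆V_c v∈V') (sym col-u≡c))

      neighbour-injective : ∀ v w nv nw → proj₁ (neighbour v nv) ≡ proj₁ (neighbour w nw) → v ≡ w
      neighbour-injective v w nv nw same =
        common-neighbour-same-color⇒≡ (proj₂ (neighbour v nv))
          (subst (λ u → E'' w u ≡ true) (sym same) (proj₂ (neighbour w nw)))
          (trans (color-c nv) (sym (color-c nw)))
        where
        color-c : ∀ {x} → NonIsolated x ≡ true → col x ≡ c
        color-c = ∈-colorClass G col V'⊆V_c ∘ proj₁ ∘ ∧≡true

      isolated-bound : count (λ v → lookup V' v ∧ isolatedᵇ E'' v) ℕ.≤ isolatedOfColor c
      isolated-bound = count-mono λ v isolated →
        let v∈V' , v-isolated = ∧≡true isolated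
        in cong₂ _∧_ v-isolated (⌊⌋≡true (col v ≟ c) (∈-colorClass G col V'⊆V_c v∈V'))

    ∣V'∣≤∣NOther∣+isolatedOfColor : ∣ V' ∣ ℕ.≤ ∣ NOther G col c V' ∣ ℕ.+ isolatedOfColor c
    ∣V'∣≤∣NOther∣+isolatedOfColor = begin
      ∣ V' ∣
        ≡⟨ ∣p∣≡count V' ⟩
      count (lookup V')
        ≡⟨ count-split (lookup V') (isolatedᵇ E'') ⟩
      count (λ v → lookup V' v ∧ isolatedᵇ E'' v) ℕ.+ count NonIsolated
        ≤⟨ ℕP.+-mono-≤ isolated-bound
             (count-≤-injection (λ v → proj₁ ∘ neighbour v) neighbour∈NOther neighbour-injective) ⟩
      isolatedOfColor c ℕ.+ count (lookup (NOther G col c V'))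
        ≡⟨ ℕP.+-comm (isolatedOfColor c) _ ⟩
      count (lookup (NOther G col c V')) ℕ.+ isolatedOfColor c
        ≡⟨ cong (ℕ._+ isolatedOfColor c) (∣p∣≡count (NOther G col c V')) ⟨
      ∣ NOther G col c V' ∣ ℕ.+ isolatedOfColor c ∎
      where open ℕP.≤-Reasoning

  s≤isolatedOfColor : ∀ c → s G col c ≤ + isolatedOfColor c
  s≤isolatedOfColor c =
    maxOver-≤ {P = _⊆ colorClass G col c} (surplus G col c) (+-∸-≤ ∘ ∣V'∣≤∣NOther∣+isolatedOfColor) (⊆-min _)
              (all-filter (_⊆? colorClass G col c) (allSubsets n))

corollary1 : ∀ {n k : ℕ} (G : SimpleGraph n) (col : Fin n → Fin k)
    (E'' : Fin n → Fin n → Bool) → IsSubgraph G E'' → AllComponentsColorful E'' col →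
    sumS G col ≤ + numIsolated E''
corollary1 {k = k} G col E'' E''⊆E colorful = begin
  sumS G col                         ≤⟨ foldr-+-≤-∑ id (s G col) isolatedOfColor s≤isolatedOfColor ⟩
  + ∑[ c < k ] isolatedOfColor c     ≡⟨ cong +_ numIsolated≡∑-isolatedOfColor ⟨
  + numIsolated E''                  ∎
  where
  open ColorfulSubgraph G col E'' E''⊆E colorful
  open ℤP.≤-Reasoning
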